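{- Let $f\colon X'\to X$ be a continuous strict $p$-morphism between Esakia spaces $X'$ and $X$, and let $x\in X'$. Then the restriction $f|_{\uparrow x}$ is a continuous bijective $p$-morphism from $\uparrow x$ onto $f[\uparrow x]=\{f(y)\mid y\in\uparrow x\}$, and its inverse $(f|_{\uparrow x})^{ -1}$ is a continuous $p$-morphism (with subspace topologies and induced orders).
   Context: For $x$ in a poset, $\uparrow x=\{x'\mid x\leqslant x'\}$, and upsets/downsets are subsets closed upward/downward. A Priestley space is a compact partially ordered topological space such that whenever $x\not\leqslant y$ there is a clopen upset $U$ with $x\in U$, $y\notin U$. An Esakia space is a Priestley space in which, for every clopen set $C$, the smallest downset $\downarrow C$ containing $C$ is clopen. A map $f$ of posets is a $p$-morphism if it is order-preserving and whenever $f(x)\leqslant y$ there is $x'\geqslant x$ with $f(x')=y$; it is strict if such $x'$ is always unique. -}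

module Defs where

open import Level using (0ℓ)
import Level
open import Data.Product using (Σ; ∃; _×_; _,_; proj₁; proj₂)
open import Data.Unit using (⊤)
open import Data.List using (List)
open import Data.List.Relation.Unary.Any using (Any)
open import Relation.Nullary using (¬_)
open import Relation.Unary using (Pred)
open import Relation.Binary.PropositionalEquality using (_≡_; refl)
open import Relation.Binary.Structures using (IsPartialOrder)

Subset : Set → Set₁
Subset X = Pred X 0ℓ

record IsTopology (X : Set) (Open : Subset X → Set) : Set₁ where
  field
    open-ext  : ∀ (U V : Subset X) → (∀ x → U x → V x) → (∀ x → V x → U x)
                → Open U → Open V
    open-univ : Open (λ _ → ⊤)
    open-∩    : ∀ (U V : Subset X) → Open U → Open V → Open (λ x → U x × V x)
    open-⋃    : ∀ (I : Set) (U : I → Subset X) → (∀ i → Open (U i))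
                → Open (λ x → ∃ λ i → U i x)

Complement : {X : Set} → Subset X → Subset X
Complement U x = ¬ U x

Clopen : {X : Set} → (Subset X → Set) → Subset X → Set
Clopen Open C = Open C × Open (Complement C)

Compact : (X : Set) → (Subset X → Set) → Set₁
Compact X Open =
  ∀ (I : Set) (U : I → Subset X) → (∀ i → Open (U i)) → (∀ x → ∃ λ i → U i x)
  → ∃ λ (is : List I) → ∀ x → Any (λ i → U i x) is

IsUpset : {X : Set} → (X → X → Set) → Subset X → Set
IsUpset _≤_ U = ∀ x y → x ≤ y → U x → U y

Up : {X : Set} → (X → X → Set) → X → Subset X
Up _≤_ x y = x ≤ y

Down : {X : Set} → (X → X → Set) → Subset X → Subset X
Down _≤_ C y = ∃ λ x → C x × y ≤ x

record EsakiaSpace : Set₁ where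
  field
    Carrier        : Set
    _≤_            : Carrier → Carrier → Set
    Open           : Subset Carrier → Set
    isTopology     : IsTopology Carrier Open
    isPartialOrder : IsPartialOrder _≡_ _≤_
    compact        : Compact Carrier Open
    priestley      : ∀ x y → ¬ (x ≤ y) →
                     ∃ λ (U : Subset Carrier) → Clopen Open U × IsUpset _≤_ U × U x × ¬ U y
    esakia         : ∀ (C : Subset Carrier) → Clopen Open C → Clopen Open (Down _≤_ C)

Continuous : ∀ {ℓ₁ ℓ₂} {A B : Set} → (Subset A → Set ℓ₁) → (Subset B → Set ℓ₂) → (A → B)
             → Set (Level.suc 0ℓ Level.⊔ ℓ₁ Level.⊔ ℓ₂)
Continuous OpenA OpenB f = ∀ (U : Subset _) → OpenB U → OpenA (λ a → U (f a))

IsPMorphism : {A B : Set} → (B → B → Set) → (A → A → Set) → (B → B → Set) → (A → B) → Set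
IsPMorphism {A} {B} _≈B_ _≤A_ _≤B_ f =
  (∀ a a' → a ≤A a' → f a ≤B f a') ×
  (∀ (a : A) (b : B) → f a ≤B b → ∃ λ a' → a ≤A a' × f a' ≈B b)

IsStrict : {A B : Set} → (A → A → Set) → (B → B → Set) → (A → A → Set) → (B → B → Set)
           → (A → B) → Set
IsStrict {A} {B} _≈A_ _≈B_ _≤A_ _≤B_ f =
  ∀ (a : A) (b : B) (a₁ a₂ : A) → f a ≤B b →
  a ≤A a₁ → f a₁ ≈B b → a ≤A a₂ → f a₂ ≈B b → a₁ ≈A a₂

Sub : (X : Set) → Subset X → Set
Sub X S = Σ X S

SubOpen : {X : Set} → (Subset X → Set) → (S : Subset X) → Subset (Sub X S) → Set₁
SubOpen {X} Open S V =
  ∃ λ (U : Subset X) → Open U × (∀ s → (V s → U (proj₁ s)) × (U (proj₁ s) → V s))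

SubLe : {X : Set} → (X → X → Set) → (S : Subset X) → Sub X S → Sub X S → Set
SubLe _≤_ S s t = proj₁ s ≤ proj₁ t

SubEq : {X : Set} → (S : Subset X) → Sub X S → Sub X S → Set
SubEq S s t = proj₁ s ≡ proj₁ t

Image : {A B : Set} → (A → B) → Subset A → Subset B
Image f S b = ∃ λ a → S a × f a ≡ b

restrict : {A B : Set} (f : A → B) (S : Subset A) → Sub A S → Sub B (Image f S)
restrict f S (a , p) = f a , (a , p , refl)

{-# OPTIONS --safe #-}
-- Strictness makes f injective on the upset ↑x, and the p-morphism conditions
-- transfer along the restriction, so the only real content is continuity of the
-- inverse. This is the classical fact that a continuous injection from a compact
-- space into a Hausdorff space is a homeomorphism onto its image: ↑x is closed
-- in X′ (the Priestley separations of x from the points outside ↑x cover its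
-- complement), and Priestley spaces are Hausdorff.
module Submission where

open import Defs
open import Level using (0ℓ)
open import Data.Product using (Σ; ∃; _×_; _,_; proj₁; proj₂)
open import Data.Empty using (⊥; ⊥-elim)
open import Data.Unit using (⊤; tt)
open import Data.List using (List; []; _∷_)
open import Data.List.Relation.Unary.All as All using (All; []; _∷_)
open import Relation.Nullary using (¬_; yes; no)
open import Relation.Binary.Definitions using (Transitive)
open import Relation.Binary.PropositionalEquality using (_≡_; _≢_; refl; sym; subst)
open import Relation.Binary.Structures using (IsPartialOrder)
open import Axiom.ExcludedMiddle using (ExcludedMiddle)

InjectiveOn : {A B : Set} → (A → B) → Subset A → Set
InjectiveOn f S = ∀ a b → S a → S b → f a ≡ f b → a ≡ b

record Separation {X : Set} (Open : Subset X → Set) (c d : X) : Set₁ where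
  field
    P Q      : Subset X
    P-open   : Open P
    Q-open   : Open Q
    c∈P      : P c
    d∈Q      : Q d
    disjoint : ∀ z → P z → Q z → ⊥

Separation-sym : {X : Set} {Open : Subset X → Set} {c d : X} →
                 Separation Open c d → Separation Open d c
Separation-sym s = record
  { P = Q ; Q = P ; P-open = Q-open ; Q-open = P-open ; c∈P = d∈Q ; d∈Q = c∈P
  ; disjoint = λ z q p → disjoint z p q }
  where open Separation s

Hausdorff : {X : Set} → (Subset X → Set) → Set₁
Hausdorff Open = ∀ c d → c ≢ d → Separation Open c d

open-⋂-finite : {X : Set} {Open : Subset X → Set} → IsTopology X Open →
                {I : Set} (Q : I → Subset X) → (∀ i → Open (Q i)) →
                (is : List I) → Open (λ z → All (λ i → Q i z) is)
open-⋂-finite top Q Q-open [] =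
  open-ext (λ _ → ⊤) _ (λ _ _ → []) (λ _ _ → tt) open-univ
  where open IsTopology top
open-⋂-finite top Q Q-open (i ∷ is) =
  open-ext (λ z → Q i z × All (λ j → Q j z) is) _
    (λ _ (q , qs) → q ∷ qs) (λ { _ (q ∷ qs) → q , qs })
    (open-∩ _ _ (Q-open i) (open-⋂-finite top Q Q-open is))
  where open IsTopology top

record OpenNeighbourhood {X : Set} (Open : Subset X → Set) (y : X) (C : Subset X) : Set₁ where
  field
    V      : Subset X
    V-open : Open V
    y∈V    : V y
    V⊆C    : ∀ z → V z → C z

open-from-neighbourhoods : {X : Set} {Open : Subset X → Set} → IsTopology X Open →
                           (C : Subset X) → (∀ y → C y → OpenNeighbourhood Open y C) → Open C
open-from-neighbourhoods {X} top C nbhd =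
  open-ext (λ z → ∃ λ i → V i z) C
    (λ { z ((y , y∈C) , z∈V) → OpenNeighbourhood.V⊆C (nbhd y y∈C) z z∈V })
    (λ z z∈C → (z , z∈C) , OpenNeighbourhood.y∈V (nbhd z z∈C))
    (open-⋃ _ V λ { (y , y∈C) → OpenNeighbourhood.V-open (nbhd y y∈C) })
  where
  open IsTopology top
  V : Σ X C → Subset X
  V (y , y∈C) = OpenNeighbourhood.V (nbhd y y∈C)

up-isUpset : {X : Set} {_≤_ : X → X → Set} → Transitive _≤_ → ∀ x → IsUpset _≤_ (Up _≤_ x)
up-isUpset trans x y z y≤z x≤y = trans x≤y y≤z

module _ (X : EsakiaSpace) where
  open EsakiaSpace X

  up-closed : ∀ x → Open (Complement (Up _≤_ x))
  up-closed x = open-from-neighbourhoods isTopology (Complement (Up _≤_ x)) nbhd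
    where
    nbhd : ∀ y → ¬ x ≤ y → OpenNeighbourhood Open y (Complement (Up _≤_ x))
    nbhd y x≰y with priestley x y x≰y
    ... | U , (_ , ∁U-open) , U-upset , x∈U , y∉U = record
      { V = Complement U ; V-open = ∁U-open ; y∈V = y∉U
      ; V⊆C = λ z z∉U x≤z → z∉U (U-upset x z x≤z x∈U) }

  separate-≰ : ∀ c d → ¬ c ≤ d → Separation Open c d
  separate-≰ c d c≰d with priestley c d c≰d
  ... | U , (U-open , ∁U-open) , _ , c∈U , d∉U = record
    { P = U ; Q = Complement U ; P-open = U-open ; Q-open = ∁U-open
    ; c∈P = c∈U ; d∈Q = d∉U ; disjoint = λ _ u ∁u → ∁u u }

  hausdorff : ExcludedMiddle 0ℓ → Hausdorff Open
  hausdorff em c d c≢d with em {c ≤ d}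
  ... | no c≰d = separate-≰ c d c≰d
  ... | yes c≤d with em {d ≤ c}
  ...   | yes d≤c = ⊥-elim (c≢d (IsPartialOrder.antisym isPartialOrder c≤d d≤c))
  ...   | no d≰c = Separation-sym (separate-≰ d c d≰c)

strict⇒injectiveOn-up : {A B : Set} {_≤A_ : A → A → Set} {_≤B_ : B → B → Set} {f : A → B} →
                        (∀ a a′ → a ≤A a′ → f a ≤B f a′) →
                        IsStrict _≡_ _≡_ _≤A_ _≤B_ f → ∀ x → InjectiveOn f (Up _≤A_ x)
strict⇒injectiveOn-up {f = f} mono strict x a b x≤a x≤b fa≡fb =
  strict x (f a) a b (mono x a x≤a) x≤a refl x≤b (sym fa≡fb)

restrict⁻¹ : {A B : Set} (f : A → B) (S : Subset A) → Sub B (Image f S) → Sub A S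
restrict⁻¹ f S (_ , a , a∈S , _) = a , a∈S

module _ {A B : Set} (f : A → B) (S : Subset A) where

  restrict∘restrict⁻¹ : ∀ t → SubEq (Image f S) (restrict f S (restrict⁻¹ f S t)) t
  restrict∘restrict⁻¹ (_ , _ , _ , fa≡b) = fa≡b

  restrict-surjective : ∀ t → ∃ λ s → SubEq (Image f S) (restrict f S s) t
  restrict-surjective t = restrict⁻¹ f S t , restrict∘restrict⁻¹ t

  restrict-injective : InjectiveOn f S →
                       ∀ s₁ s₂ → SubEq (Image f S) (restrict f S s₁) (restrict f S s₂) → SubEq S s₁ s₂
  restrict-injective f-inj (a , a∈S) (b , b∈S) = f-inj a b a∈S b∈S

  restrict-continuous : {OpenA : Subset A → Set} {OpenB : Subset B → Set} →
                        Continuous OpenA OpenB f →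
                        Continuous (SubOpen OpenA S) (SubOpen OpenB (Image f S)) (restrict f S)
  restrict-continuous f-cont V (U , U-open , V⇔U) =
    (λ a → U (f a)) , f-cont U U-open , λ s → V⇔U (restrict f S s)

  module _ {_≤A_ : A → A → Set} {_≤B_ : B → B → Set}
           (S-upset : IsUpset _≤A_ S) (f-pmor : IsPMorphism _≡_ _≤A_ _≤B_ f) where

    private
      mono : ∀ a a′ → a ≤A a′ → f a ≤B f a′
      mono = proj₁ f-pmor
      lift : ∀ a b → f a ≤B b → ∃ λ a′ → a ≤A a′ × f a′ ≡ b
      lift = proj₂ f-pmor

    restrict-isPMorphism :
      IsPMorphism (SubEq (Image f S)) (SubLe _≤A_ S) (SubLe _≤B_ (Image f S)) (restrict f S)
    restrict-isPMorphism =
        (λ s s′ → mono (proj₁ s) (proj₁ s′))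
      , λ { (a , a∈S) t fa≤t →
              let (a′ , a≤a′ , fa′≡t) = lift a (proj₁ t) fa≤t
              in (a′ , S-upset a a′ a≤a′ a∈S) , a≤a′ , fa′≡t }

    restrict⁻¹-isPMorphism : InjectiveOn f S →
      IsPMorphism (SubEq S) (SubLe _≤B_ (Image f S)) (SubLe _≤A_ S) (restrict⁻¹ f S)
    restrict⁻¹-isPMorphism f-inj = restrict⁻¹-mono , restrict⁻¹-lift
      where
      restrict⁻¹-mono : ∀ t t′ → SubLe _≤B_ (Image f S) t t′ →
                        SubLe _≤A_ S (restrict⁻¹ f S t) (restrict⁻¹ f S t′)
      restrict⁻¹-mono (_ , a , a∈S , refl) (_ , b , b∈S , refl) fa≤fb =
        let (c , a≤c , fc≡fb) = lift a (f b) fa≤fb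
        in subst (a ≤A_) (f-inj c b (S-upset a c a≤c a∈S) b∈S fc≡fb) a≤c
      restrict⁻¹-lift : ∀ t s → SubLe _≤A_ S (restrict⁻¹ f S t) s →
                        ∃ λ t′ → SubLe _≤B_ (Image f S) t t′ × SubEq S (restrict⁻¹ f S t′) s
      restrict⁻¹-lift (_ , a , _ , refl) s a≤s = restrict f S s , mono a (proj₁ s) a≤s , refl

module _ (em : ExcludedMiddle 0ℓ) {A B : Set} {OpenA : Subset A → Set} {OpenB : Subset B → Set}
         (B-top : IsTopology B OpenB) (A-compact : Compact A OpenA) (B-hausdorff : Hausdorff OpenB)
         {f : A → B} (f-cont : Continuous OpenA OpenB f)
         {K : Subset A} (K-closed : OpenA (Complement K)) (f-inj : InjectiveOn f K) where

  -- Cover A by U, by A ∖ K, and, for each y ∈ K ∖ U, by the preimage of a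
  -- neighbourhood of f y disjoint from a guard neighbourhood of f a. The guards
  -- of a finite subcover intersect to a neighbourhood of f a missing f[K ∖ U].
  module _ {U : Subset A} (U-open : OpenA U) {a : A} (a∈K : K a) (a∈U : U a) where

    data Piece : Set where
      inside outside : Piece
      apart          : ∀ y → K y → ¬ U y → Piece

    separation : ∀ y → K y → ¬ U y → Separation OpenB (f y) (f a)
    separation y y∈K y∉U =
      B-hausdorff (f y) (f a) λ fy≡fa → y∉U (subst U (sym (f-inj y a y∈K a∈K fy≡fa)) a∈U)

    domain : Piece → Subset A
    domain inside            = U
    domain outside           = Complement K
    domain (apart y y∈K y∉U) = λ z → Separation.P (separation y y∈K y∉U) (f z)

    guard : Piece → Subset B
    guard inside            = λ _ → ⊤
    guard outside           = λ _ → ⊤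
    guard (apart y y∈K y∉U) = Separation.Q (separation y y∈K y∉U)

    domain-open : ∀ i → OpenA (domain i)
    domain-open inside            = U-open
    domain-open outside           = K-closed
    domain-open (apart y y∈K y∉U) = f-cont _ (Separation.P-open (separation y y∈K y∉U))

    guard-open : ∀ i → OpenB (guard i)
    guard-open inside            = IsTopology.open-univ B-top
    guard-open outside           = IsTopology.open-univ B-top
    guard-open (apart y y∈K y∉U) = Separation.Q-open (separation y y∈K y∉U)

    guard-fa : ∀ i → guard i (f a)
    guard-fa inside            = tt
    guard-fa outside           = tt
    guard-fa (apart y y∈K y∉U) = Separation.d∈Q (separation y y∈K y∉U)

    domain-covers : ∀ z → ∃ λ i → domain i z
    domain-covers z with em {U z} | em {K z}
    ... | yes z∈U | _       = inside , z∈U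
    ... | no _    | no z∉K  = outside , z∉K
    ... | no z∉U  | yes z∈K = apart z z∈K z∉U , Separation.c∈P (separation z z∈K z∉U)

    guarded-domain⊆U : ∀ {b} → K b → ∀ i → guard i (f b) → domain i b → U b
    guarded-domain⊆U b∈K inside            _ b∈U  = b∈U
    guarded-domain⊆U b∈K outside           _ b∉K  = ⊥-elim (b∉K b∈K)
    guarded-domain⊆U b∈K (apart y y∈K y∉U) fb∈Q fb∈P =
      ⊥-elim (Separation.disjoint (separation y y∈K y∉U) _ fb∈P fb∈Q)

    image-neighbourhood : OpenNeighbourhood OpenB (f a) (λ z → ∀ b → K b → f b ≡ z → U b)
    image-neighbourhood with A-compact Piece domain domain-open domain-covers
    ... | pieces , covered = record
      { V      = λ z → All (λ i → guard i z) pieces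
      ; V-open = open-⋂-finite B-top guard guard-open pieces
      ; y∈V    = All.universal guard-fa pieces
      ; V⊆C    = λ { _ fb∈V b b∈K refl →
                   All.lookupWith (λ {i} → guarded-domain⊆U b∈K i) fb∈V (covered b) }
      }

  restrict⁻¹-continuous :
    Continuous (SubOpen OpenB (Image f K)) (SubOpen OpenA K) (restrict⁻¹ f K)
  restrict⁻¹-continuous V (U , U-open , V⇔U) =
      W , IsTopology.open-⋃ B-top Centre N (λ c → OpenNeighbourhood.V-open (nbhd c))
    , λ { (_ , a , a∈K , refl) → into a a∈K , out-of a a∈K }
    where
    Centre : Set
    Centre = Σ A λ a → K a × U a
    nbhd : (c : Centre) → OpenNeighbourhood OpenB (f (proj₁ c)) (λ z → ∀ b → K b → f b ≡ z → U b)
    nbhd (a , a∈K , a∈U) = image-neighbourhood U-open a∈K a∈U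
    N : Centre → Subset B
    N c = OpenNeighbourhood.V (nbhd c)
    W : Subset B
    W z = ∃ λ c → N c z
    into : ∀ a a∈K → V (a , a∈K) → W (f a)
    into a a∈K a∈V = c , OpenNeighbourhood.y∈V (nbhd c)
      where
      c : Centre
      c = a , a∈K , proj₁ (V⇔U (a , a∈K)) a∈V
    out-of : ∀ a a∈K → W (f a) → V (a , a∈K)
    out-of a a∈K (c , fa∈N) =
      proj₂ (V⇔U (a , a∈K)) (OpenNeighbourhood.V⊆C (nbhd c) (f a) fa∈N a a∈K refl)

lemma8 : ExcludedMiddle 0ℓ →
    (X′ X : EsakiaSpace) (f : EsakiaSpace.Carrier X′ → EsakiaSpace.Carrier X) →
    Continuous (EsakiaSpace.Open X′) (EsakiaSpace.Open X) f →
    IsPMorphism _≡_ (EsakiaSpace._≤_ X′) (EsakiaSpace._≤_ X) f →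
    IsStrict _≡_ _≡_ (EsakiaSpace._≤_ X′) (EsakiaSpace._≤_ X) f →
    (x : EsakiaSpace.Carrier X′) →
    let S = Up (EsakiaSpace._≤_ X′) x
        T = Image f S
        r = restrict f S
    in Continuous (SubOpen (EsakiaSpace.Open X′) S) (SubOpen (EsakiaSpace.Open X) T) r
       × IsPMorphism (SubEq T) (SubLe (EsakiaSpace._≤_ X′) S) (SubLe (EsakiaSpace._≤_ X) T) r
       × (∀ s₁ s₂ → SubEq T (r s₁) (r s₂) → SubEq S s₁ s₂)
       × (∀ t → ∃ λ s → SubEq T (r s) t)
       × (∃ λ (g : Sub (EsakiaSpace.Carrier X) T → Sub (EsakiaSpace.Carrier X′) S) →
            (∀ s → SubEq S (g (r s)) s)
            × (∀ t → SubEq T (r (g t)) t)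
            × Continuous (SubOpen (EsakiaSpace.Open X) T) (SubOpen (EsakiaSpace.Open X′) S) g
            × IsPMorphism (SubEq S) (SubLe (EsakiaSpace._≤_ X) T) (SubLe (EsakiaSpace._≤_ X′) S) g)
lemma8 em X′ X f f-cont f-pmor f-strict x =
    restrict-continuous f S f-cont
  , restrict-isPMorphism f S {_≤B_ = EsakiaSpace._≤_ X} S-upset f-pmor
  , restrict-injective f S f-inj
  , restrict-surjective f S
  , ( restrict⁻¹ f S
    , (λ _ → refl)
    , restrict∘restrict⁻¹ f S
    , restrict⁻¹-continuous em (EsakiaSpace.isTopology X) (EsakiaSpace.compact X′)
        (hausdorff X em) f-cont (up-closed X′ x) f-inj
    , restrict⁻¹-isPMorphism f S {_≤B_ = EsakiaSpace._≤_ X} S-upset f-pmor f-inj )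
  where
  S : Subset (EsakiaSpace.Carrier X′)
  S = Up (EsakiaSpace._≤_ X′) x
  S-upset : IsUpset (EsakiaSpace._≤_ X′) S
  S-upset = up-isUpset (IsPartialOrder.trans (EsakiaSpace.isPartialOrder X′)) x
  f-inj : InjectiveOn f S
  f-inj = strict⇒injectiveOn-up {_≤B_ = EsakiaSpace._≤_ X} (proj₁ f-pmor) f-strict x
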